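{- Let $S$ be a Foulis m-semilattice and let $[S]=\{[t]:t\in S\}$ be its orthomodular lattice of Sasaki projections. For $t\in S$ put $t^\perp=[t^*]$. Then $[S]$ is a left $S$-module with action $u\bullet k=(u\cdot k)^{\perp\perp}$ for $u\in S$, $k\in[S]$, and also a right $\mathbf 2$-module.
   Context: An m-semilattice is a join-semilattice $(S,\sqcup,0)$ with an associative multiplication $\cdot$ distributing over finite joins on both sides; unital if it has a two-sided unit $e$; involutive if it has ${}^*$ with $s^{**}=s$, $(s\cdot t)^*=t^*\cdot s^*$, $(\bigsqcup_i x_i)^*=\bigsqcup_i x_i^*$ (finite families). A Foulis semigroup is a monoid $(S,\cdot,e)$ with maps ${}^*$ and $[-]$ such that: $e^*=e$, $(st)^*=t^*s^*$, $s^{**}=s$; $[s]\cdot[s]=[s]=[s]^*$; $0:=[e]$ satisfies $0\cdot s=0=s\cdot0$; and $s\cdot t=0$ iff $t=[s]\cdot y$ for some $y$. A Foulis m-semilattice is an involutive unital m-semilattice which with its multiplication and involution is a Foulis semigroup. The set $[S]$ is an orthomodular lattice with order $k_1\le k_2\iff k_1=k_2\cdot k_1$, top $e$, orthocomplement $k\mapsto[k]$, and finite joins $\bigvee X=[[\bigsqcup X]]$; the module is taken with respect to this join-semilattice structure. For a unital m-semilattice $S$, a left $S$-module is a join-semilattice $(A,\vee,0)$ with $\bullet\colon S\times A\to A$ such that: $s\bullet\bigvee B=\bigvee_{x\in B}s\bullet x$ for finite $B$; $(\bigsqcup T)\bullet a=\bigvee_{t\in T}t\bullet a$ for finite $T$;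 $u\bullet(v\bullet a)=(u\cdot v)\bullet a$; $e\bullet a=a$. $\mathbf 2=\{0,1\}$ is the two-element chain with multiplication meet; any join-semilattice is a right $\mathbf 2$-module via $a\cdot1=a$, $a\cdot0=0$. -}

module Defs where

open import Level using (Level; _⊔_) renaming (suc to lsuc)
open import Data.Bool using (Bool; true; false; _∧_; _∨_)
open import Data.Product using (Σ; ∃; _×_; _,_)
open import Relation.Binary.PropositionalEquality using (_≡_)
open import Function.Bundles using (_⇔_)

-- Equality is propositional equality on the carrier.
-- "Finite joins" are expressed by the binary and the nullary (empty) case.
record FoulisMSemilattice (ℓ : Level) : Set (lsuc ℓ) where
  infixl 6 _⊔ˢ_
  infixl 7 _·_
  field
    Carrier : Set ℓ
    _⊔ˢ_    : Carrier → Carrier → Carrier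
    0ˢ      : Carrier
    ⊔-assoc : ∀ x y z → (x ⊔ˢ y) ⊔ˢ z ≡ x ⊔ˢ (y ⊔ˢ z)
    ⊔-comm  : ∀ x y → x ⊔ˢ y ≡ y ⊔ˢ x
    ⊔-idem  : ∀ x → x ⊔ˢ x ≡ x
    ⊔-identityˡ : ∀ x → 0ˢ ⊔ˢ x ≡ x
    _·_     : Carrier → Carrier → Carrier
    ·-assoc : ∀ x y z → (x · y) · z ≡ x · (y · z)
    ·-distribˡ-⊔ : ∀ s x y → s · (x ⊔ˢ y) ≡ s · x ⊔ˢ s · y
    ·-distribʳ-⊔ : ∀ s x y → (x ⊔ˢ y) · s ≡ x · s ⊔ˢ y · s
    ·-zeroʳ : ∀ s → s · 0ˢ ≡ 0ˢ
    ·-zeroˡ : ∀ s → 0ˢ · s ≡ 0ˢ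
    e       : Carrier
    ·-identityˡ : ∀ s → e · s ≡ s
    ·-identityʳ : ∀ s → s · e ≡ s
    _*      : Carrier → Carrier
    *-invol : ∀ s → (s *) * ≡ s
    *-anti  : ∀ s t → (s · t) * ≡ (t *) · (s *)
    *-⊔     : ∀ x y → (x ⊔ˢ y) * ≡ (x *) ⊔ˢ (y *)
    *-0     : 0ˢ * ≡ 0ˢ
    [_]     : Carrier → Carrier
    e*      : e * ≡ e
    []-idem : ∀ s → [ s ] · [ s ] ≡ [ s ]
    []-self : ∀ s → [ s ] * ≡ [ s ]
    []e-zeroˡ : ∀ s → [ e ] · s ≡ [ e ]
    []e-zeroʳ : ∀ s → s · [ e ] ≡ [ e ]
    foulis  : ∀ s t → (s · t ≡ [ e ]) ⇔ (∃ λ y → t ≡ [ s ] · y)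

record IsJoinSemilatticeOn {a p} {A : Set a} (P : A → Set p)
    (_∨ᴬ_ : A → A → A) (0ᴬ : A) : Set (a ⊔ p) where
  field
    ∨-closed : ∀ {x y} → P x → P y → P (x ∨ᴬ y)
    0-closed : P 0ᴬ
    ∨-assoc  : ∀ {x y z} → P x → P y → P z → (x ∨ᴬ y) ∨ᴬ z ≡ x ∨ᴬ (y ∨ᴬ z)
    ∨-comm   : ∀ {x y} → P x → P y → x ∨ᴬ y ≡ y ∨ᴬ x
    ∨-idem   : ∀ {x} → P x → x ∨ᴬ x ≡ x
    ∨-identityˡ : ∀ {x} → P x → 0ᴬ ∨ᴬ x ≡ x

record IsLeftModuleOn {s a p} (S : Set s) (_⊔S_ : S → S → S) (0S : S)
    (_·S_ : S → S → S) (eS : S)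
    {A : Set a} (P : A → Set p) (_∨ᴬ_ : A → A → A) (0ᴬ : A)
    (_•_ : S → A → A) : Set (s ⊔ a ⊔ p) where
  field
    isJoinSemilattice : IsJoinSemilatticeOn P _∨ᴬ_ 0ᴬ
    •-closed    : ∀ u {x} → P x → P (u • x)
    •-distrib-∨ : ∀ u {x y} → P x → P y → u • (x ∨ᴬ y) ≡ (u • x) ∨ᴬ (u • y)
    •-zero      : ∀ u → u • 0ᴬ ≡ 0ᴬ
    ⊔-distrib-• : ∀ u v {x} → P x → (u ⊔S v) • x ≡ (u • x) ∨ᴬ (v • x)
    0S-•        : ∀ {x} → P x → 0S • x ≡ 0ᴬ
    •-assoc     : ∀ u v {x} → P x → u • (v • x) ≡ (u ·S v) • x
    •-identity  : ∀ {x} → P x → eS • x ≡ x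

record IsRightModuleOn {r a p} (R : Set r) (_⊔R_ : R → R → R) (0R : R)
    (_·R_ : R → R → R) (eR : R)
    {A : Set a} (P : A → Set p) (_∨ᴬ_ : A → A → A) (0ᴬ : A)
    (_◃_ : A → R → A) : Set (r ⊔ a ⊔ p) where
  field
    isJoinSemilattice : IsJoinSemilatticeOn P _∨ᴬ_ 0ᴬ
    ◃-closed    : ∀ {x} u → P x → P (x ◃ u)
    ∨-distrib-◃ : ∀ u {x y} → P x → P y → (x ∨ᴬ y) ◃ u ≡ (x ◃ u) ∨ᴬ (y ◃ u)
    0-◃         : ∀ u → 0ᴬ ◃ u ≡ 0ᴬ
    ◃-distrib-⊔ : ∀ u v {x} → P x → x ◃ (u ⊔R v) ≡ (x ◃ u) ∨ᴬ (x ◃ v)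
    ◃-0R        : ∀ {x} → P x → x ◃ 0R ≡ 0ᴬ
    ◃-assoc     : ∀ u v {x} → P x → (x ◃ u) ◃ v ≡ x ◃ (u ·R v)
    ◃-identity  : ∀ {x} → P x → x ◃ eR ≡ x

-- Action of the two-element chain 2 = (Bool, ∨, false, ∧, true) on any
-- pointed set: a·1 = a, a·0 = 0.
act2 : ∀ {a} {A : Set a} → A → A → Bool → A
act2 0ᴬ x true  = x
act2 0ᴬ x false = 0ᴬ

module FoulisNotions {ℓ} (S : FoulisMSemilattice ℓ) where
  open FoulisMSemilattice S

  IsProj : Carrier → Set ℓ
  IsProj k = ∃ λ t → k ≡ [ t ]

  _⊥ : Carrier → Carrier
  t ⊥ = [ t * ]

  -- finite joins in [S]: ⋁X = [[⊔X]]
  _∨ₖ_ : Carrier → Carrier → Carrier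
  k₁ ∨ₖ k₂ = [ [ k₁ ⊔ˢ k₂ ] ]

  0ₖ : Carrier
  0ₖ = [ [ 0ˢ ] ]

  _•_ : Carrier → Carrier → Carrier
  u • k = ((u · k) ⊥) ⊥

  _◃₂_ : Carrier → Bool → Carrier
  k ◃₂ b = act2 0ₖ k b

{-# OPTIONS --safe #-}
module Submission where

open import Defs
open import Level using (Level)
open import Data.Bool using (Bool; true; false; _∧_; _∨_)
open import Data.Product using (_×_; _,_; ∃; proj₁; proj₂; map)
open import Relation.Unary using (Pred; _⊆_; _≐_; _∩_)
open import Relation.Binary.PropositionalEquality
  using (_≡_; refl; sym; trans; cong; cong₂; subst; module ≡-Reasoning)
open import Function.Bundles using (_⇔_; Equivalence)

-- Proof idea: [x] = [y] holds exactly when x and y have the same right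
-- annihilators, and the right annihilator of a ⊔ b (resp. a · w) is
-- determined by those of a and b (resp. of a).  Hence [a ⊔ b] and [a · w]
-- only depend on [a], [b], and since [[[a]]] = [a] the closure a ↦ [[a]]
-- may be inserted or removed inside joins and left factors at will.  For a
-- projection k we have u • k = [[k · u*]], and every module law becomes a
-- semiring identity in S under this closure.

act2-isRightModule : ∀ {a p} {A : Set a} {P : A → Set p} {_∨ᴬ_ : A → A → A} {0ᴬ : A} →
  IsJoinSemilatticeOn P _∨ᴬ_ 0ᴬ →
  IsRightModuleOn Bool _∨_ false _∧_ true P _∨ᴬ_ 0ᴬ (act2 0ᴬ)
act2-isRightModule {P = P} {_∨ᴬ_} {0ᴬ} isJS = record
  { isJoinSemilattice = isJS
  ; ◃-closed    = closed
  ; ∨-distrib-◃ = ∨-distrib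
  ; 0-◃         = λ { true → refl ; false → refl }
  ; ◃-distrib-⊔ = distrib-∨
  ; ◃-0R        = λ _ → refl
  ; ◃-assoc     = assoc
  ; ◃-identity  = λ _ → refl
  }
  where
  open IsJoinSemilatticeOn isJS

  closed : ∀ {x} u → P x → P (act2 0ᴬ x u)
  closed true  px = px
  closed false _  = 0-closed

  ∨-distrib : ∀ u {x y} → P x → P y →
    act2 0ᴬ (x ∨ᴬ y) u ≡ act2 0ᴬ x u ∨ᴬ act2 0ᴬ y u
  ∨-distrib true  _ _ = refl
  ∨-distrib false _ _ = sym (∨-idem 0-closed)

  distrib-∨ : ∀ u v {x} → P x → act2 0ᴬ x (u ∨ v) ≡ act2 0ᴬ x u ∨ᴬ act2 0ᴬ x v
  distrib-∨ true  true  px = sym (∨-idem px)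
  distrib-∨ true  false px = sym (trans (∨-comm px 0-closed) (∨-identityˡ px))
  distrib-∨ false true  px = sym (∨-identityˡ px)
  distrib-∨ false false _  = sym (∨-idem 0-closed)

  assoc : ∀ u v {x} → P x → act2 0ᴬ (act2 0ᴬ x u) v ≡ act2 0ᴬ x (u ∧ v)
  assoc true  _     _ = refl
  assoc false true  _ = refl
  assoc false false _ = refl

module FoulisProperties {ℓ} (S : FoulisMSemilattice ℓ) where
  open FoulisMSemilattice S
  open FoulisNotions S
  open ≡-Reasoning

  0ˢ≡[e] : 0ˢ ≡ [ e ]
  0ˢ≡[e] = trans (sym (·-zeroˡ [ e ])) ([]e-zeroʳ 0ˢ)

  foulis₀ : ∀ s t → (s · t ≡ 0ˢ) ⇔ (∃ λ y → t ≡ [ s ] · y)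
  foulis₀ s t = subst (λ z → (s · t ≡ z) ⇔ _) (sym 0ˢ≡[e]) (foulis s t)

  Ann : Carrier → Pred Carrier ℓ
  Ann s t = s · t ≡ 0ˢ

  Ann⇒[]-fixes : ∀ {s t} → Ann s t → [ s ] · t ≡ t
  Ann⇒[]-fixes {s} {t} st≡0 with Equivalence.to (foulis₀ s t) st≡0
  ... | y , refl = trans (sym (·-assoc _ _ _)) (cong (_· y) ([]-idem s))

  Ann-[] : ∀ s → Ann s [ s ]
  Ann-[] s = Equivalence.from (foulis₀ s [ s ]) (e , sym (·-identityʳ _))

  []-·-*-zero : ∀ s → [ s ] · s * ≡ 0ˢ
  []-·-*-zero s = begin
    [ s ] · s *       ≡⟨ cong (_· s *) (sym ([]-self s)) ⟩
    [ s ] * · s *     ≡⟨ sym (*-anti s [ s ]) ⟩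
    (s · [ s ]) *     ≡⟨ cong _* (Ann-[] s) ⟩
    0ˢ *              ≡⟨ *-0 ⟩
    0ˢ                ∎

  ·-[[]]-identityʳ : ∀ s → s · [ [ s ] ] ≡ s
  ·-[[]]-identityʳ s = begin
    s · [ [ s ] ]              ≡⟨ cong₂ _·_ (sym (*-invol s)) (sym ([]-self _)) ⟩
    (s *) * · [ [ s ] ] *      ≡⟨ sym (*-anti _ _) ⟩
    ([ [ s ] ] · s *) *        ≡⟨ cong _* (Ann⇒[]-fixes ([]-·-*-zero s)) ⟩
    (s *) *                    ≡⟨ *-invol s ⟩
    s                          ∎

  [[[]]] : ∀ s → [ [ [ s ] ] ] ≡ [ s ]
  [[[]]] s = begin
    [ [ [ s ] ] ]                  ≡⟨ sym (Ann⇒[]-fixes s·[[[s]]]≡0) ⟩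
    [ s ] · [ [ [ s ] ] ]          ≡⟨ ·-[[]]-identityʳ [ s ] ⟩
    [ s ]                          ∎
    where
    s·[[[s]]]≡0 : s · [ [ [ s ] ] ] ≡ 0ˢ
    s·[[[s]]]≡0 = begin
      s · [ [ [ s ] ] ]                  ≡⟨ cong (_· [ [ [ s ] ] ]) (sym (·-[[]]-identityʳ s)) ⟩
      (s · [ [ s ] ]) · [ [ [ s ] ] ]    ≡⟨ ·-assoc _ _ _ ⟩
      s · ([ [ s ] ] · [ [ [ s ] ] ])    ≡⟨ cong (s ·_) (Ann-[] [ [ s ] ]) ⟩
      s · 0ˢ                             ≡⟨ ·-zeroʳ s ⟩
      0ˢ                                 ∎

  []≡⇒Ann⊆ : ∀ {x y} → [ x ] ≡ [ y ] → Ann x ⊆ Ann y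
  []≡⇒Ann⊆ {x} {y} [x]≡[y] {t} xt≡0 with Equivalence.to (foulis₀ x t) xt≡0
  ... | z , t≡[x]z = Equivalence.from (foulis₀ y t) (z , trans t≡[x]z (cong (_· z) [x]≡[y]))

  []≡⇒Ann≐ : ∀ {x y} → [ x ] ≡ [ y ] → Ann x ≐ Ann y
  []≡⇒Ann≐ [x]≡[y] = []≡⇒Ann⊆ [x]≡[y] , []≡⇒Ann⊆ (sym [x]≡[y])

  Ann⊆⇒[]-absorbs : ∀ {x y} → Ann x ⊆ Ann y → [ y ] · [ x ] ≡ [ x ]
  Ann⊆⇒[]-absorbs {x} x⊆y = Ann⇒[]-fixes (x⊆y (Ann-[] x))

  Ann≐⇒[]≡ : ∀ {x y} → Ann x ≐ Ann y → [ x ] ≡ [ y ]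
  Ann≐⇒[]≡ {x} {y} (x⊆y , y⊆x) = begin
    [ x ]                ≡⟨ sym ([]-self x) ⟩
    [ x ] *              ≡⟨ cong _* (sym (Ann⊆⇒[]-absorbs x⊆y)) ⟩
    ([ y ] · [ x ]) *    ≡⟨ *-anti _ _ ⟩
    [ x ] * · [ y ] *    ≡⟨ cong₂ _·_ ([]-self x) ([]-self y) ⟩
    [ x ] · [ y ]        ≡⟨ Ann⊆⇒[]-absorbs y⊆x ⟩
    [ y ]                ∎

  ⊔-conicalˡ : ∀ a b → a ⊔ˢ b ≡ 0ˢ → a ≡ 0ˢ
  ⊔-conicalˡ a b a⊔b≡0 = begin
    a                  ≡⟨ sym (⊔-identityˡ a) ⟩
    0ˢ ⊔ˢ a            ≡⟨ ⊔-comm _ _ ⟩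
    a ⊔ˢ 0ˢ            ≡⟨ cong (a ⊔ˢ_) (sym a⊔b≡0) ⟩
    a ⊔ˢ (a ⊔ˢ b)      ≡⟨ sym (⊔-assoc _ _ _) ⟩
    (a ⊔ˢ a) ⊔ˢ b      ≡⟨ cong (_⊔ˢ b) (⊔-idem a) ⟩
    a ⊔ˢ b             ≡⟨ a⊔b≡0 ⟩
    0ˢ                 ∎

  ⊔-conicalʳ : ∀ a b → a ⊔ˢ b ≡ 0ˢ → b ≡ 0ˢ
  ⊔-conicalʳ a b a⊔b≡0 = ⊔-conicalˡ b a (trans (⊔-comm b a) a⊔b≡0)

  Ann-⊔ : ∀ a b → Ann (a ⊔ˢ b) ≐ Ann a ∩ Ann b
  Ann-⊔ a b = to∩ , from∩
    where
    to∩ : Ann (a ⊔ˢ b) ⊆ Ann a ∩ Ann b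
    to∩ {t} [a⊔b]t≡0 = ⊔-conicalˡ _ _ at⊔bt≡0 , ⊔-conicalʳ _ _ at⊔bt≡0
      where at⊔bt≡0 = trans (sym (·-distribʳ-⊔ t a b)) [a⊔b]t≡0
    from∩ : Ann a ∩ Ann b ⊆ Ann (a ⊔ˢ b)
    from∩ {t} (at≡0 , bt≡0) =
      trans (·-distribʳ-⊔ t a b) (trans (cong₂ _⊔ˢ_ at≡0 bt≡0) (⊔-idem 0ˢ))

  Ann-⊔-mono : ∀ {a a′ b b′} → Ann a ⊆ Ann a′ → Ann b ⊆ Ann b′ →
               Ann (a ⊔ˢ b) ⊆ Ann (a′ ⊔ˢ b′)
  Ann-⊔-mono {a} {a′} {b} {b′} a⊆a′ b⊆b′ t∈ =
    proj₂ (Ann-⊔ a′ b′) (map a⊆a′ b⊆b′ (proj₁ (Ann-⊔ a b) t∈))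

  Ann-·-mono : ∀ {a a′} w → Ann a ⊆ Ann a′ → Ann (a · w) ⊆ Ann (a′ · w)
  Ann-·-mono {a} {a′} w a⊆a′ {t} [aw]t≡0 =
    trans (·-assoc a′ w t) (a⊆a′ (trans (sym (·-assoc a w t)) [aw]t≡0))

  []-cong-⊔ : ∀ {a a′ b b′} → [ a ] ≡ [ a′ ] → [ b ] ≡ [ b′ ] → [ a ⊔ˢ b ] ≡ [ a′ ⊔ˢ b′ ]
  []-cong-⊔ [a]≡[a′] [b]≡[b′] = Ann≐⇒[]≡
    ( Ann-⊔-mono (proj₁ ([]≡⇒Ann≐ [a]≡[a′])) (proj₁ ([]≡⇒Ann≐ [b]≡[b′]))
    , Ann-⊔-mono (proj₂ ([]≡⇒Ann≐ [a]≡[a′])) (proj₂ ([]≡⇒Ann≐ [b]≡[b′])) )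

  []-cong-·ˡ : ∀ {a a′} w → [ a ] ≡ [ a′ ] → [ a · w ] ≡ [ a′ · w ]
  []-cong-·ˡ w [a]≡[a′] = Ann≐⇒[]≡
    ( Ann-·-mono w (proj₁ ([]≡⇒Ann≐ [a]≡[a′]))
    , Ann-·-mono w (proj₂ ([]≡⇒Ann≐ [a]≡[a′])) )

  [[]]-⊔ : ∀ a b → [ [ a ⊔ˢ b ] ] ≡ [ [ [ [ a ] ] ⊔ˢ [ [ b ] ] ] ]
  [[]]-⊔ a b = cong [_] ([]-cong-⊔ (sym ([[[]]] a)) (sym ([[[]]] b)))

  [[]]-·ˡ : ∀ a w → [ [ [ [ a ] ] · w ] ] ≡ [ [ a · w ] ]
  [[]]-·ˡ a w = cong [_] ([]-cong-·ˡ w ([[[]]] a))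

  proj-self : ∀ {k} → IsProj k → k * ≡ k
  proj-self (t , refl) = []-self t

  proj-[[]] : ∀ {k} → IsProj k → [ [ k ] ] ≡ k
  proj-[[]] (t , refl) = [[[]]] t

  0ₖ≡0ˢ : 0ₖ ≡ 0ˢ
  0ₖ≡0ˢ = begin
    [ [ 0ˢ ] ]       ≡⟨ cong (λ z → [ [ z ] ]) 0ˢ≡[e] ⟩
    [ [ [ e ] ] ]    ≡⟨ [[[]]] e ⟩
    [ e ]            ≡⟨ sym 0ˢ≡[e] ⟩
    0ˢ               ∎

  •-proj : ∀ u {k} → IsProj k → u • k ≡ [ [ k · u * ] ]
  •-proj u {k} pk = begin
    [ [ (u · k) * ] * ]     ≡⟨ cong [_] ([]-self _) ⟩
    [ [ (u · k) * ] ]       ≡⟨ cong (λ z → [ [ z ] ]) (*-anti u k) ⟩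
    [ [ k * · u * ] ]       ≡⟨ cong (λ z → [ [ z · u * ] ]) (proj-self pk) ⟩
    [ [ k · u * ] ]         ∎

  •-closed : ∀ u {k} → IsProj k → IsProj (u • k)
  •-closed u {k} _ = [ (u · k) * ] * , refl

  isJoinSemilattice : IsJoinSemilatticeOn IsProj _∨ₖ_ 0ₖ
  isJoinSemilattice = record
    { ∨-closed    = λ {x} {y} _ _ → [ x ⊔ˢ y ] , refl
    ; 0-closed    = [ 0ˢ ] , refl
    ; ∨-assoc     = λ {x} {y} {z} _ _ _ → begin
        [ [ [ [ x ⊔ˢ y ] ] ⊔ˢ z ] ]    ≡⟨ cong [_] ([]-cong-⊔ ([[[]]] (x ⊔ˢ y)) refl) ⟩
        [ [ (x ⊔ˢ y) ⊔ˢ z ] ]          ≡⟨ cong (λ w → [ [ w ] ]) (⊔-assoc x y z) ⟩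
        [ [ x ⊔ˢ (y ⊔ˢ z) ] ]          ≡⟨ cong [_] ([]-cong-⊔ refl (sym ([[[]]] (y ⊔ˢ z)))) ⟩
        [ [ x ⊔ˢ [ [ y ⊔ˢ z ] ] ] ]    ∎
    ; ∨-comm      = λ {x} {y} _ _ → cong (λ w → [ [ w ] ]) (⊔-comm x y)
    ; ∨-idem      = λ {x} px → trans (cong (λ w → [ [ w ] ]) (⊔-idem x)) (proj-[[]] px)
    ; ∨-identityˡ = λ {x} px → begin
        [ [ [ [ 0ˢ ] ] ⊔ˢ x ] ]        ≡⟨ cong [_] ([]-cong-⊔ ([[[]]] 0ˢ) refl) ⟩
        [ [ 0ˢ ⊔ˢ x ] ]                ≡⟨ cong (λ w → [ [ w ] ]) (⊔-identityˡ x) ⟩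
        [ [ x ] ]                      ≡⟨ proj-[[]] px ⟩
        x                              ∎
    }

  •-distrib-∨ : ∀ u {x y} → IsProj x → IsProj y → u • (x ∨ₖ y) ≡ (u • x) ∨ₖ (u • y)
  •-distrib-∨ u {x} {y} px py = begin
    u • (x ∨ₖ y)                                      ≡⟨ •-proj u ([ x ⊔ˢ y ] , refl) ⟩
    [ [ [ [ x ⊔ˢ y ] ] · u * ] ]                      ≡⟨ [[]]-·ˡ (x ⊔ˢ y) (u *) ⟩
    [ [ (x ⊔ˢ y) · u * ] ]                            ≡⟨ cong (λ w → [ [ w ] ]) (·-distribʳ-⊔ _ x y) ⟩
    [ [ x · u * ⊔ˢ y · u * ] ]                        ≡⟨ [[]]-⊔ _ _ ⟩
    [ [ [ [ x · u * ] ] ⊔ˢ [ [ y · u * ] ] ] ]        ≡⟨ sym (cong₂ _∨ₖ_ (•-proj u px) (•-proj u py)) ⟩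
    (u • x) ∨ₖ (u • y)                                ∎

  •-zero : ∀ u → u • 0ₖ ≡ 0ₖ
  •-zero u = begin
    u • 0ₖ                ≡⟨ •-proj u ([ 0ˢ ] , refl) ⟩
    [ [ 0ₖ · u * ] ]      ≡⟨ cong (λ w → [ [ w · u * ] ]) 0ₖ≡0ˢ ⟩
    [ [ 0ˢ · u * ] ]      ≡⟨ cong (λ w → [ [ w ] ]) (·-zeroˡ _) ⟩
    0ₖ                    ∎

  ⊔-distrib-• : ∀ u v {x} → IsProj x → (u ⊔ˢ v) • x ≡ (u • x) ∨ₖ (v • x)
  ⊔-distrib-• u v {x} px = begin
    (u ⊔ˢ v) • x                                      ≡⟨ •-proj (u ⊔ˢ v) px ⟩
    [ [ x · (u ⊔ˢ v) * ] ]                            ≡⟨ cong (λ w → [ [ x · w ] ]) (*-⊔ u v) ⟩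
    [ [ x · (u * ⊔ˢ v *) ] ]                          ≡⟨ cong (λ w → [ [ w ] ]) (·-distribˡ-⊔ x _ _) ⟩
    [ [ x · u * ⊔ˢ x · v * ] ]                        ≡⟨ [[]]-⊔ _ _ ⟩
    [ [ [ [ x · u * ] ] ⊔ˢ [ [ x · v * ] ] ] ]        ≡⟨ sym (cong₂ _∨ₖ_ (•-proj u px) (•-proj v px)) ⟩
    (u • x) ∨ₖ (v • x)                                ∎

  0ˢ-• : ∀ {x} → IsProj x → 0ˢ • x ≡ 0ₖ
  0ˢ-• {x} px = begin
    0ˢ • x                ≡⟨ •-proj 0ˢ px ⟩
    [ [ x · 0ˢ * ] ]      ≡⟨ cong (λ w → [ [ x · w ] ]) *-0 ⟩
    [ [ x · 0ˢ ] ]        ≡⟨ cong (λ w → [ [ w ] ]) (·-zeroʳ x) ⟩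
    0ₖ                    ∎

  •-assoc : ∀ u v {x} → IsProj x → u • (v • x) ≡ (u · v) • x
  •-assoc u v {x} px = begin
    u • (v • x)                       ≡⟨ •-proj u (•-closed v px) ⟩
    [ [ (v • x) · u * ] ]             ≡⟨ cong (λ w → [ [ w · u * ] ]) (•-proj v px) ⟩
    [ [ [ [ x · v * ] ] · u * ] ]     ≡⟨ [[]]-·ˡ (x · v *) (u *) ⟩
    [ [ (x · v *) · u * ] ]           ≡⟨ cong (λ w → [ [ w ] ]) (·-assoc x _ _) ⟩
    [ [ x · (v * · u *) ] ]           ≡⟨ cong (λ w → [ [ x · w ] ]) (sym (*-anti u v)) ⟩
    [ [ x · (u · v) * ] ]             ≡⟨ sym (•-proj (u · v) px) ⟩
    (u · v) • x                       ∎

  •-identity : ∀ {x} → IsProj x → e • x ≡ x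
  •-identity {x} px = begin
    e • x                 ≡⟨ •-proj e px ⟩
    [ [ x · e * ] ]       ≡⟨ cong (λ w → [ [ x · w ] ]) e* ⟩
    [ [ x · e ] ]         ≡⟨ cong (λ w → [ [ w ] ]) (·-identityʳ x) ⟩
    [ [ x ] ]             ≡⟨ proj-[[]] px ⟩
    x                     ∎

  isLeftModule : IsLeftModuleOn Carrier _⊔ˢ_ 0ˢ _·_ e IsProj _∨ₖ_ 0ₖ _•_
  isLeftModule = record
    { isJoinSemilattice = isJoinSemilattice
    ; •-closed          = •-closed
    ; •-distrib-∨       = •-distrib-∨
    ; •-zero            = •-zero
    ; ⊔-distrib-•       = ⊔-distrib-•
    ; 0S-•              = 0ˢ-•
    ; •-assoc           = •-assoc
    ; •-identity        = •-identity
    }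

mainTheorem11 : ∀ {ℓ : Level} (S : FoulisMSemilattice ℓ) →
    let open FoulisMSemilattice S
        open FoulisNotions S
    in IsLeftModuleOn Carrier _⊔ˢ_ 0ˢ _·_ e IsProj _∨ₖ_ 0ₖ _•_
       × IsRightModuleOn Bool _∨_ false _∧_ true IsProj _∨ₖ_ 0ₖ _◃₂_
mainTheorem11 S = isLeftModule , act2-isRightModule isJoinSemilattice
  where open FoulisProperties S
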